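{- For a nonnegative integer $n$, let $A(n)=\left[\binom{i+j}{i}\right]_{0\le i,j\le n}$ and $B(n)=\left[(-1)^{i+j}\sum_{m=0}^n\binom{m}{i}\binom{m}{j}\right]_{0\le i,j\le n}$, both $(n+1)\times(n+1)$ matrices. Then $A(n)$ and $B(n)$ are inverse to each other. -}

module Defs where

open import Data.Nat using (ℕ; zero; suc; _+_)
open import Data.Nat.Combinatorics using (_C_)
open import Data.Fin using (Fin; toℕ; _≟_)
import Data.Fin as Fin
open import Relation.Nullary using (yes; no)
open import Data.Integer as ℤ using (ℤ; +_; 0ℤ; 1ℤ; -_)

Matrix : ℕ → Set
Matrix k = Fin k → Fin k → ℤ

sumFin : (k : ℕ) → (Fin k → ℤ) → ℤ
sumFin zero    f = 0ℤ
sumFin (suc k) f = f Fin.zero ℤ.+ sumFin k (λ i → f (Fin.suc i))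

_⊗_ : {k : ℕ} → Matrix k → Matrix k → Matrix k
_⊗_ {k} M N i j = sumFin k (λ l → M i l ℤ.* N l j)

I : (k : ℕ) → Matrix k
I k i j with i ≟ j
... | yes _ = 1ℤ
... | no  _ = 0ℤ

signPow : ℕ → ℤ
signPow zero          = 1ℤ
signPow (suc zero)    = - 1ℤ
signPow (suc (suc e)) = signPow e

A : (n : ℕ) → Matrix (suc n)
A n i j = + ((toℕ i + toℕ j) C toℕ i)

binSum : ℕ → ℕ → ℕ → ℕ
binSum zero    i j = (0 C i) Data.Nat.* (0 C j)
binSum (suc n) i j = binSum n i j + (suc n C i) Data.Nat.* (suc n C j)

B : (n : ℕ) → Matrix (suc n)
B n i j = signPow (toℕ i + toℕ j) ℤ.* + binSum n (toℕ i) (toℕ j)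

-- Let K = n + 1, let P = [C(i,j)] be the K × K lower triangular Pascal matrix, Pᵀ its
-- transpose, and S = diag((-1)^i).  Two classical binomial identities drive the proof:
--
--   * Pascal inversion    Σ_l C(i,l) (-1)^l C(l,j) = (-1)^i δ_ij,  i.e.  P S P = S,
--     and by transposition  Pᵀ S Pᵀ = S;
--   * Vandermonde         Σ_m C(i,m) C(j,m) = C(i+j, i),           i.e.  A = P Pᵀ;
--
-- while B = (S Pᵀ)(P S) holds by definition.  Since S S = 1, associativity gives
--   A B = P (Pᵀ S Pᵀ) P S = (P S P) S = S S = 1,   B A = S Pᵀ (P S P) Pᵀ = S (Pᵀ S Pᵀ) = 1.
module Submission where

open import Data.Fin as Fin using (Fin; toℕ; _≟_)
open import Data.Fin.Properties using (toℕ<n; toℕ-inject₁; toℕ-fromℕ)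
open import Data.Integer using (ℤ; +_; 0ℤ; 1ℤ; -1ℤ; -_; _+_; _*_)
import Data.Integer.Properties as ℤP
open import Algebra.Properties.Semiring.Sum ℤP.+-*-semiring using (sum; sum-cong-≗; sum-init-last; sum-replicate-zero; ∑-distrib-+; ∑-comm; *-distribˡ-sum; *-distribʳ-sum)
open import Data.Integer.Tactic.RingSolver using (solve-∀)
open import Data.Nat as ℕ using (ℕ; zero; suc; _<_; s≤s)
import Data.Nat.Properties as ℕP
open import Data.Nat.Combinatorics using (_C_; nCk+nC[k+1]≡[n+1]C[k+1]; nCn≡1)
open import Data.Nat.Combinatorics.Specification using (k>n⇒nCk≡0)
open import Data.Product using (_×_; _,_)
open import Function using (_∘_)
open import Relation.Binary.Bundles using (Setoid)
import Relation.Binary.Reasoning.Setoid as SetoidReasoning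
open import Relation.Binary.PropositionalEquality
open import Relation.Nullary using (yes; no)

open import Defs

sumFin≡sum : ∀ k (f : Fin k → ℤ) → sumFin k f ≡ sum f
sumFin≡sum zero    f = refl
sumFin≡sum (suc k) f = cong (λ s → f Fin.zero + s) (sumFin≡sum k (f ∘ Fin.suc))

-- Sums of ℕ-indexed terms over 0 ≤ l < K.  By definition
-- sumBelow (suc K) f = f 0 + sumBelow K (f ∘ suc).
sumBelow : ℕ → (ℕ → ℤ) → ℤ
sumBelow K f = sum (λ (l : Fin K) → f (toℕ l))

sumBelow-cong : ∀ K {f g : ℕ → ℤ} → (∀ l → f l ≡ g l) → sumBelow K f ≡ sumBelow K g
sumBelow-cong K f≗g = sum-cong-≗ {K} (f≗g ∘ toℕ)

sumBelow-+ : ∀ K (f g : ℕ → ℤ) → sumBelow K (λ l → f l + g l) ≡ sumBelow K f + sumBelow K g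
sumBelow-+ K f g = ∑-distrib-+ {K} (f ∘ toℕ) (g ∘ toℕ)

sumBelow-*ˡ : ∀ K x (f : ℕ → ℤ) → sumBelow K (λ l → x * f l) ≡ x * sumBelow K f
sumBelow-*ˡ K x f = sym (*-distribˡ-sum {K} x (f ∘ toℕ))

sumBelow-neg : ∀ K (f : ℕ → ℤ) → sumBelow K (λ l → - f l) ≡ - sumBelow K f
sumBelow-neg K f = begin
  sumBelow K (λ l → - f l)       ≡⟨ sumBelow-cong K (λ l → sym (ℤP.-1*i≡-i (f l))) ⟩
  sumBelow K (λ l → -1ℤ * f l)   ≡⟨ sumBelow-*ˡ K -1ℤ f ⟩
  -1ℤ * sumBelow K f             ≡⟨ ℤP.-1*i≡-i (sumBelow K f) ⟩
  - sumBelow K f                 ∎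
  where open ≡-Reasoning

sumBelow-snoc : ∀ K (f : ℕ → ℤ) → sumBelow (suc K) f ≡ sumBelow K f + f K
sumBelow-snoc K f = trans (sum-init-last (λ (l : Fin (suc K)) → f (toℕ l)))
  (cong₂ _+_ (sum-cong-≗ {K} (cong f ∘ toℕ-inject₁)) (cong f (toℕ-fromℕ K)))

sumBelow-drop-last : ∀ K (f : ℕ → ℤ) → f K ≡ 0ℤ → sumBelow (suc K) f ≡ sumBelow K f
sumBelow-drop-last K f fK≡0 = begin
  sumBelow (suc K) f   ≡⟨ sumBelow-snoc K f ⟩
  sumBelow K f + f K   ≡⟨ cong (λ t → sumBelow K f + t) fK≡0 ⟩
  sumBelow K f + 0ℤ    ≡⟨ ℤP.+-identityʳ (sumBelow K f) ⟩
  sumBelow K f         ∎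
  where open ≡-Reasoning

signPow-suc : ∀ e → signPow (suc e) ≡ - signPow e
signPow-suc zero          = refl
signPow-suc (suc zero)    = refl
signPow-suc (suc (suc e)) = signPow-suc e

signPow-+ : ∀ d e → signPow (d ℕ.+ e) ≡ signPow d * signPow e
signPow-+ zero    e = sym (ℤP.*-identityˡ (signPow e))
signPow-+ (suc d) e = begin
  signPow (suc (d ℕ.+ e))       ≡⟨ signPow-suc (d ℕ.+ e) ⟩
  - signPow (d ℕ.+ e)           ≡⟨ cong -_ (signPow-+ d e) ⟩
  - (signPow d * signPow e)     ≡⟨ ℤP.neg-distribˡ-* (signPow d) (signPow e) ⟩
  - signPow d * signPow e       ≡⟨ cong (_* signPow e) (sym (signPow-suc d)) ⟩
  signPow (suc d) * signPow e   ∎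
  where open ≡-Reasoning

signPow-square : ∀ e → signPow e * signPow e ≡ 1ℤ
signPow-square zero          = refl
signPow-square (suc zero)    = refl
signPow-square (suc (suc e)) = signPow-square e

-- The Kronecker delta on ℕ, by recursion so that δ (suc i) (suc j) = δ i j holds by definition.
δ : ℕ → ℕ → ℤ
δ zero    zero    = 1ℤ
δ zero    (suc _) = 0ℤ
δ (suc _) zero    = 0ℤ
δ (suc i) (suc j) = δ i j

δ-weighted-sym : ∀ (f : ℕ → ℤ) i j → f i * δ i j ≡ f j * δ j i
δ-weighted-sym f zero    zero    = refl
δ-weighted-sym f zero    (suc j) = trans (ℤP.*-zeroʳ (f 0)) (sym (ℤP.*-zeroʳ (f (suc j))))
δ-weighted-sym f (suc i) zero    = trans (ℤP.*-zeroʳ (f (suc i))) (sym (ℤP.*-zeroʳ (f 0)))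
δ-weighted-sym f (suc i) (suc j) = δ-weighted-sym (f ∘ suc) i j

I-suc : ∀ {k} (i j : Fin k) → I (suc k) (Fin.suc i) (Fin.suc j) ≡ I k i j
I-suc i j with i ≟ j
... | yes _ = refl
... | no  _ = refl

I≡δ : ∀ {k} (i j : Fin k) → I k i j ≡ δ (toℕ i) (toℕ j)
I≡δ Fin.zero    Fin.zero    = refl
I≡δ Fin.zero    (Fin.suc j) = refl
I≡δ (Fin.suc i) Fin.zero    = refl
I≡δ (Fin.suc i) (Fin.suc j) = trans (I-suc i j) (I≡δ i j)

I-sym : ∀ {k} (i j : Fin k) → I k i j ≡ I k j i
I-sym Fin.zero    Fin.zero    = refl
I-sym Fin.zero    (Fin.suc j) = refl
I-sym (Fin.suc i) Fin.zero    = refl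
I-sym (Fin.suc i) (Fin.suc j) = trans (I-suc i j) (trans (I-sym i j) (sym (I-suc j i)))

c : ℕ → ℕ → ℤ
c a b = + (a C b)

c-pascal : ∀ a b → c (suc a) (suc b) ≡ c a b + c a (suc b)
c-pascal a b = trans (cong +_ (sym (nCk+nC[k+1]≡[n+1]C[k+1] a b))) (ℤP.pos-+ (a C b) (a C suc b))

-- C(a, b) = 0 for b > a; this makes all truncated sums below independent of K.
c-vanish : ∀ {a b} → a < b → c a b ≡ 0ℤ
c-vanish a<b = cong +_ (k>n⇒nCk≡0 a<b)

expand-left : ∀ K a (h : ℕ → ℤ) →
  sumBelow K (λ m → c (suc a) (suc m) * h m) ≡
  sumBelow K (λ m → c a m * h m) + sumBelow K (λ m → c a (suc m) * h m)
expand-left K a h = trans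
  (sumBelow-cong K (λ m → trans (cong (_* h m) (c-pascal a m)) (ℤP.*-distribʳ-+ (h m) (c a m) (c a (suc m)))))
  (sumBelow-+ K (λ m → c a m * h m) (λ m → c a (suc m) * h m))

expand-right : ∀ K (h : ℕ → ℤ) b →
  sumBelow K (λ m → h m * c (suc b) (suc m)) ≡
  sumBelow K (λ m → h m * c b m) + sumBelow K (λ m → h m * c b (suc m))
expand-right K h b = trans
  (sumBelow-cong K (λ m → trans (cong (h m *_) (c-pascal b m)) (ℤP.*-distribˡ-+ (h m) (c b m) (c b (suc m)))))
  (sumBelow-+ K (λ m → h m * c b m) (λ m → h m * c b (suc m)))

-- Pascal inversion:  Σ_l C(i,l) (-1)^l C(l,j) = (-1)^i δ_ij

-- Entry (i, j) of P S P, the inner index running over l < K.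
alternating : ℕ → ℕ → ℕ → ℤ
alternating K i j = sumBelow K (λ l → c i l * (signPow l * c l j))

-- For i < K the terms with l ≥ K vanish, so enlarging K changes nothing.
alternating-truncate : ∀ {K i} j → i < K → alternating (suc K) i j ≡ alternating K i j
alternating-truncate {K} {i} j i<K =
  sumBelow-drop-last K (λ l → c i l * (signPow l * c l j)) (cong (λ z → z * (signPow K * c K j)) (c-vanish i<K))

-- Pascal's rule C(i+1, l+1) = C(i, l) + C(i, l+1) together with (-1)^(l+1) = -(-1)^l
-- relates row i+1 of P S P to row i.
alternating-step : ∀ {K i} j → i < K →
  alternating (suc K) (suc i) j ≡ alternating K i j + - sumBelow K (λ l → c i l * (signPow l * c (suc l) j))
alternating-step {K} {i} j i<K = begin
  front + sumBelow K (λ l → c (suc i) (suc l) * shifted l)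
    ≡⟨ cong (λ t → front + t) (expand-left K i shifted) ⟩
  front + (lower + upper)
    ≡⟨ swap-last front lower upper ⟩
  alternating (suc K) i j + lower
    ≡⟨ cong₂ _+_ (alternating-truncate j i<K) (trans (sumBelow-cong K sign-flip) (sumBelow-neg K unsigned)) ⟩
  alternating K i j + - sumBelow K unsigned ∎
  where
  open ≡-Reasoning
  front : ℤ
  front = c i 0 * (signPow 0 * c 0 j)
  shifted unsigned : ℕ → ℤ
  shifted l = signPow (suc l) * c (suc l) j
  unsigned l = c i l * (signPow l * c (suc l) j)
  lower upper : ℤ
  lower = sumBelow K (λ l → c i l * shifted l)
  upper = sumBelow K (λ l → c i (suc l) * shifted l)
  swap-last : ∀ x y z → x + (y + z) ≡ (x + z) + y
  swap-last = solve-∀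
  neg-middle : ∀ a s t → a * (- s * t) ≡ - (a * (s * t))
  neg-middle = solve-∀
  sign-flip : ∀ l → c i l * shifted l ≡ - unsigned l
  sign-flip l = trans (cong (λ s → c i l * (s * c (suc l) j)) (signPow-suc l)) (neg-middle (c i l) (signPow l) (c (suc l) j))

-- In column 0 the shifted sum is row i itself, since C(l+1, 0) = C(l, 0).
alternating-first-column : ∀ {K i} → i < K → alternating (suc K) (suc i) 0 ≡ 0ℤ
alternating-first-column {K} {i} i<K =
  trans (alternating-step 0 i<K) (ℤP.+-inverseʳ (alternating K i 0))

-- In column j+1, Pascal's rule splits the shifted sum into columns j and j+1.
alternating-recurrence : ∀ {K i} j → i < K → alternating (suc K) (suc i) (suc j) ≡ - alternating K i j
alternating-recurrence {K} {i} j i<K = begin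
  alternating (suc K) (suc i) (suc j)
    ≡⟨ alternating-step (suc j) i<K ⟩
  alternating K i (suc j) + - sumBelow K (λ l → c i l * (signPow l * c (suc l) (suc j)))
    ≡⟨ cong (λ t → alternating K i (suc j) + - t) (trans (sumBelow-cong K expand) (sumBelow-+ K (row j) (row (suc j)))) ⟩
  alternating K i (suc j) + - (alternating K i j + alternating K i (suc j))
    ≡⟨ cancel (alternating K i (suc j)) (alternating K i j) ⟩
  - alternating K i j ∎
  where
  open ≡-Reasoning
  distrib : ∀ a s u v → a * (s * (u + v)) ≡ a * (s * u) + a * (s * v)
  distrib = solve-∀
  cancel : ∀ y x → y + - (x + y) ≡ - x
  cancel = solve-∀
  row : ℕ → ℕ → ℤ
  row j′ l = c i l * (signPow l * c l j′)
  expand : ∀ l → c i l * (signPow l * c (suc l) (suc j)) ≡ row j l + row (suc j) l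
  expand l = trans (cong (λ t → c i l * (signPow l * t)) (c-pascal l j)) (distrib (c i l) (signPow l) (c l j) (c l (suc j)))

pascal-inversion : ∀ K i j → i < K → alternating K i j ≡ signPow i * δ i j
pascal-inversion (suc K) zero    zero    _         = cong (λ s → 1ℤ + s) (sum-replicate-zero K)
pascal-inversion (suc K) zero    (suc j) _         = trans (ℤP.+-identityˡ _) (sum-replicate-zero K)
pascal-inversion (suc K) (suc i) zero    (s≤s i<K) =
  trans (alternating-first-column i<K) (sym (ℤP.*-zeroʳ (signPow (suc i))))
pascal-inversion (suc K) (suc i) (suc j) (s≤s i<K) = begin
  alternating (suc K) (suc i) (suc j)  ≡⟨ alternating-recurrence j i<K ⟩
  - alternating K i j                  ≡⟨ cong -_ (pascal-inversion K i j i<K) ⟩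
  - (signPow i * δ i j)                ≡⟨ ℤP.neg-distribˡ-* (signPow i) (δ i j) ⟩
  - signPow i * δ i j                  ≡⟨ cong (_* δ i j) (sym (signPow-suc i)) ⟩
  signPow (suc i) * δ (suc i) (suc j)  ∎
  where open ≡-Reasoning

-- Vandermonde:  Σ_m C(i,m) C(j,m) = C(i+j, i)

-- Entry (i, j) of P Pᵀ, the inner index running over m < K.
vandermonde-sum : ℕ → ℕ → ℕ → ℤ
vandermonde-sum K i j = sumBelow K (λ m → c i m * c j m)

-- For i < K the terms with m ≥ K vanish, so enlarging K changes nothing.
vandermonde-truncate : ∀ {K i} j → i < K → vandermonde-sum (suc K) i j ≡ vandermonde-sum K i j
vandermonde-truncate {K} {i} j i<K =
  sumBelow-drop-last K (λ m → c i m * c j m) (cong (_* c j K) (c-vanish i<K))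

-- Pascal's rule in both indices:  V(i+1, j+1) = V(i, j+1) + V(i+1, j).
-- Here V(a, b) = 1 + tail a b, the first term C(a,0) C(b,0) being 1.
vandermonde-step : ∀ {K i} j → i < K →
  vandermonde-sum (suc K) (suc i) (suc j) ≡ vandermonde-sum (suc K) i (suc j) + vandermonde-sum (suc K) (suc i) j
vandermonde-step {K} {i} j i<K = begin
  1ℤ + tail (suc i) (suc j)
    ≡⟨ cong (λ t → 1ℤ + t) (expand-left K i (λ m → c (suc j) (suc m))) ⟩
  1ℤ + (sumBelow K (λ m → c i m * c (suc j) (suc m)) + tail i (suc j))
    ≡⟨ cong (λ t → 1ℤ + (t + tail i (suc j))) (expand-right K (c i) j) ⟩
  1ℤ + ((vandermonde-sum K i j + mixed) + tail i (suc j))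
    ≡⟨ cong (λ t → 1ℤ + ((t + mixed) + tail i (suc j))) (sym (vandermonde-truncate j i<K)) ⟩
  1ℤ + (((1ℤ + tail i j) + mixed) + tail i (suc j))
    ≡⟨ regroup (tail i j) mixed (tail i (suc j)) ⟩
  (1ℤ + tail i (suc j)) + (1ℤ + (mixed + tail i j))
    ≡⟨ cong (λ t → (1ℤ + tail i (suc j)) + (1ℤ + t)) (sym (expand-left K i (λ m → c j (suc m)))) ⟩
  (1ℤ + tail i (suc j)) + (1ℤ + tail (suc i) j) ∎
  where
  open ≡-Reasoning
  tail : ℕ → ℕ → ℤ
  tail a b = sumBelow K (λ m → c a (suc m) * c b (suc m))
  mixed : ℤ
  mixed = sumBelow K (λ m → c i m * c j (suc m))
  regroup : ∀ t y t′ → 1ℤ + (((1ℤ + t) + y) + t′) ≡ (1ℤ + t′) + (1ℤ + (y + t))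
  regroup = solve-∀

c-pascal-diagonal : ∀ i j → c (i ℕ.+ suc j) i + c (suc i ℕ.+ j) (suc i) ≡ c (suc i ℕ.+ suc j) (suc i)
c-pascal-diagonal i j rewrite ℕP.+-suc i j = sym (c-pascal (suc (i ℕ.+ j)) i)

vandermonde : ∀ K i j → i < K → vandermonde-sum K i j ≡ c (i ℕ.+ j) i
vandermonde (suc K) zero    j       _         = cong (λ s → 1ℤ + s) (sum-replicate-zero K)
vandermonde (suc K) (suc i) zero    _         = begin
  1ℤ + sumBelow K (λ m → c (suc i) (suc m) * 0ℤ)
    ≡⟨ cong (λ s → 1ℤ + s) (trans (sumBelow-cong K (λ m → ℤP.*-zeroʳ (c (suc i) (suc m)))) (sum-replicate-zero K)) ⟩
  1ℤ
    ≡⟨ cong +_ (sym (trans (cong (_C suc i) (ℕP.+-identityʳ (suc i))) (nCn≡1 (suc i)))) ⟩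
  c (suc i ℕ.+ 0) (suc i) ∎
  where open ≡-Reasoning
vandermonde (suc K) (suc i) (suc j) (s≤s i<K) = begin
  vandermonde-sum (suc K) (suc i) (suc j)
    ≡⟨ vandermonde-step j i<K ⟩
  vandermonde-sum (suc K) i (suc j) + vandermonde-sum (suc K) (suc i) j
    ≡⟨ cong₂ _+_ (vandermonde (suc K) i (suc j) (ℕP.m<n⇒m<1+n i<K)) (vandermonde (suc K) (suc i) j (s≤s i<K)) ⟩
  c (i ℕ.+ suc j) i + c (suc i ℕ.+ j) (suc i)
    ≡⟨ c-pascal-diagonal i j ⟩
  c (suc i ℕ.+ suc j) (suc i) ∎
  where open ≡-Reasoning

-- Matrix algebra

_≋_ : ∀ {k} → Matrix k → Matrix k → Set
M ≋ N = ∀ i j → M i j ≡ N i j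

≋-refl : ∀ {k} {M : Matrix k} → M ≋ M
≋-refl i j = refl

≋-setoid : ℕ → Setoid _ _
≋-setoid k = record
  { Carrier       = Matrix k
  ; _≈_           = _≋_
  ; isEquivalence = record
    { refl  = ≋-refl
    ; sym   = λ M≋N i j → sym (M≋N i j)
    ; trans = λ L≋M M≋N i j → trans (L≋M i j) (M≋N i j)
    }
  }

⊗-sum : ∀ {k} (M N : Matrix k) i j → (M ⊗ N) i j ≡ sum (λ l → M i l * N l j)
⊗-sum {k} M N i j = sumFin≡sum k (λ l → M i l * N l j)

⊗-cong : ∀ {k} {M M′ N N′ : Matrix k} → M ≋ M′ → N ≋ N′ → (M ⊗ N) ≋ (M′ ⊗ N′)
⊗-cong {M = M} {M′} {N} {N′} M≋M′ N≋N′ i j = begin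
  (M ⊗ N) i j                   ≡⟨ ⊗-sum M N i j ⟩
  sum (λ l → M i l * N l j)     ≡⟨ sum-cong-≗ (λ l → cong₂ _*_ (M≋M′ i l) (N≋N′ l j)) ⟩
  sum (λ l → M′ i l * N′ l j)   ≡⟨ ⊗-sum M′ N′ i j ⟨
  (M′ ⊗ N′) i j                 ∎
  where open ≡-Reasoning

⊗-congˡ : ∀ {k} (L : Matrix k) {M N : Matrix k} → M ≋ N → (L ⊗ M) ≋ (L ⊗ N)
⊗-congˡ L = ⊗-cong {M = L} ≋-refl

⊗-congʳ : ∀ {k} (R : Matrix k) {M N : Matrix k} → M ≋ N → (M ⊗ R) ≋ (N ⊗ R)
⊗-congʳ R M≋N = ⊗-cong {N = R} M≋N ≋-refl

-- Associativity: distribute, exchange the two sums, and factor again.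
⊗-assoc : ∀ {k} (L M N : Matrix k) → ((L ⊗ M) ⊗ N) ≋ (L ⊗ (M ⊗ N))
⊗-assoc L M N i j = begin
  ((L ⊗ M) ⊗ N) i j
    ≡⟨ ⊗-sum (L ⊗ M) N i j ⟩
  sum (λ l → (L ⊗ M) i l * N l j)
    ≡⟨ sum-cong-≗ (λ l → cong (_* N l j) (⊗-sum L M i l)) ⟩
  sum (λ l → sum (λ p → L i p * M p l) * N l j)
    ≡⟨ sum-cong-≗ (λ l → *-distribʳ-sum (N l j) (λ p → L i p * M p l)) ⟩
  sum (λ l → sum (λ p → L i p * M p l * N l j))
    ≡⟨ ∑-comm (λ l p → L i p * M p l * N l j) ⟩
  sum (λ p → sum (λ l → L i p * M p l * N l j))
    ≡⟨ sum-cong-≗ (λ p → sum-cong-≗ (λ l → ℤP.*-assoc (L i p) (M p l) (N l j))) ⟩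
  sum (λ p → sum (λ l → L i p * (M p l * N l j)))
    ≡⟨ sum-cong-≗ (λ p → *-distribˡ-sum (L i p) (λ l → M p l * N l j)) ⟨
  sum (λ p → L i p * sum (λ l → M p l * N l j))
    ≡⟨ sum-cong-≗ (λ p → cong (L i p *_) (⊗-sum M N p j)) ⟨
  sum (λ p → L i p * (M ⊗ N) p j)
    ≡⟨ ⊗-sum L (M ⊗ N) i j ⟨
  (L ⊗ (M ⊗ N)) i j ∎
  where open ≡-Reasoning

sift-row : ∀ {k} (i : Fin k) (x : Fin k → ℤ) → sum (λ l → I k i l * x l) ≡ x i
sift-row {suc k} Fin.zero    x = trans (cong₂ _+_ (ℤP.*-identityˡ (x Fin.zero)) (sum-replicate-zero k))
                                       (ℤP.+-identityʳ (x Fin.zero))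
sift-row {suc k} (Fin.suc i) x = trans (ℤP.+-identityˡ _)
  (trans (sum-cong-≗ (λ l → cong (_* x (Fin.suc l)) (I-suc i l))) (sift-row i (x ∘ Fin.suc)))

sift-column : ∀ {k} (j : Fin k) (x : Fin k → ℤ) → sum (λ l → x l * I k l j) ≡ x j
sift-column {k} j x = trans
  (sum-cong-≗ (λ l → trans (ℤP.*-comm (x l) (I k l j)) (cong (_* x l) (I-sym l j))))
  (sift-row j x)

diag : ∀ {k} → (Fin k → ℤ) → Matrix k
diag {k} s i j = s i * I k i j

diag-⊗ : ∀ {k} (s : Fin k → ℤ) (M : Matrix k) → (diag s ⊗ M) ≋ (λ i j → s i * M i j)
diag-⊗ {k} s M i j = begin
  (diag s ⊗ M) i j                     ≡⟨ ⊗-sum (diag s) M i j ⟩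
  sum (λ l → s i * I k i l * M l j)    ≡⟨ sum-cong-≗ (λ l → ℤP.*-assoc (s i) (I k i l) (M l j)) ⟩
  sum (λ l → s i * (I k i l * M l j))  ≡⟨ *-distribˡ-sum (s i) (λ l → I k i l * M l j) ⟨
  s i * sum (λ l → I k i l * M l j)    ≡⟨ cong (s i *_) (sift-row i (λ l → M l j)) ⟩
  s i * M i j                          ∎
  where open ≡-Reasoning

⊗-diag : ∀ {k} (M : Matrix k) (s : Fin k → ℤ) → (M ⊗ diag s) ≋ (λ i j → M i j * s j)
⊗-diag {k} M s i j = begin
  (M ⊗ diag s) i j                     ≡⟨ ⊗-sum M (diag s) i j ⟩
  sum (λ l → M i l * (s l * I k l j))  ≡⟨ sum-cong-≗ (λ l → ℤP.*-assoc (M i l) (s l) (I k l j)) ⟨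
  sum (λ l → M i l * s l * I k l j)    ≡⟨ sift-column j (λ l → M i l * s l) ⟩
  M i j * s j                          ∎
  where open ≡-Reasoning

-- The Pascal matrices and the inverse pair

module PascalMatrices (K : ℕ) where

  P Pᵀ S : Matrix K
  P  i j = c (toℕ i) (toℕ j)
  Pᵀ i j = c (toℕ j) (toℕ i)
  S      = diag (signPow ∘ toℕ)

  PSP≋S : ((P ⊗ S) ⊗ P) ≋ S
  PSP≋S i j = begin
    ((P ⊗ S) ⊗ P) i j                              ≡⟨ ⊗-sum (P ⊗ S) P i j ⟩
    sum (λ l → (P ⊗ S) i l * P l j)                ≡⟨ sum-cong-≗ (λ l → cong (_* P l j) (⊗-diag P (signPow ∘ toℕ) i l)) ⟩
    sumBelow K (λ l → c i′ l * signPow l * c l j′) ≡⟨ sumBelow-cong K (λ l → ℤP.*-assoc (c i′ l) (signPow l) (c l j′)) ⟩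
    alternating K i′ j′                            ≡⟨ pascal-inversion K i′ j′ (toℕ<n i) ⟩
    signPow i′ * δ i′ j′                           ≡⟨ cong (signPow i′ *_) (I≡δ i j) ⟨
    S i j                                          ∎
    where
    open ≡-Reasoning
    i′ = toℕ i
    j′ = toℕ j

  -- The transposed identity; Pascal inversion with the roles of i and j exchanged.
  PᵀSPᵀ≋S : ((Pᵀ ⊗ S) ⊗ Pᵀ) ≋ S
  PᵀSPᵀ≋S i j = begin
    ((Pᵀ ⊗ S) ⊗ Pᵀ) i j                            ≡⟨ ⊗-sum (Pᵀ ⊗ S) Pᵀ i j ⟩
    sum (λ l → (Pᵀ ⊗ S) i l * Pᵀ l j)              ≡⟨ sum-cong-≗ (λ l → cong (_* Pᵀ l j) (⊗-diag Pᵀ (signPow ∘ toℕ) i l)) ⟩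
    sumBelow K (λ l → c l i′ * signPow l * c j′ l) ≡⟨ sumBelow-cong K (λ l → mirror (c l i′) (signPow l) (c j′ l)) ⟩
    alternating K j′ i′                            ≡⟨ pascal-inversion K j′ i′ (toℕ<n j) ⟩
    signPow j′ * δ j′ i′                           ≡⟨ δ-weighted-sym signPow j′ i′ ⟩
    signPow i′ * δ i′ j′                           ≡⟨ cong (signPow i′ *_) (I≡δ i j) ⟨
    S i j                                          ∎
    where
    open ≡-Reasoning
    i′ = toℕ i
    j′ = toℕ j
    mirror : ∀ a s b → a * s * b ≡ b * (s * a)
    mirror = solve-∀

  SS≋I : (S ⊗ S) ≋ I K
  SS≋I i j = begin
    (S ⊗ S) i j                      ≡⟨ diag-⊗ (signPow ∘ toℕ) S i j ⟩
    s * (s * I K i j)                ≡⟨ ℤP.*-assoc s s (I K i j) ⟨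
    s * s * I K i j                  ≡⟨ cong (_* I K i j) (signPow-square (toℕ i)) ⟩
    1ℤ * I K i j                     ≡⟨ ℤP.*-identityˡ (I K i j) ⟩
    I K i j                          ∎
    where
    open ≡-Reasoning
    s = signPow (toℕ i)

  -- (P Pᵀ) and (S Pᵀ)(P S) are mutually inverse: reassociate until the
  -- factors P S P, Pᵀ S Pᵀ and S S appear.
  right-inverse : ((P ⊗ Pᵀ) ⊗ ((S ⊗ Pᵀ) ⊗ (P ⊗ S))) ≋ I K
  right-inverse = begin
    (P ⊗ Pᵀ) ⊗ ((S ⊗ Pᵀ) ⊗ (P ⊗ S))   ≈⟨ ⊗-assoc P Pᵀ ((S ⊗ Pᵀ) ⊗ (P ⊗ S)) ⟩
    P ⊗ (Pᵀ ⊗ ((S ⊗ Pᵀ) ⊗ (P ⊗ S)))   ≈⟨ ⊗-congˡ P (⊗-assoc Pᵀ (S ⊗ Pᵀ) (P ⊗ S)) ⟨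
    P ⊗ ((Pᵀ ⊗ (S ⊗ Pᵀ)) ⊗ (P ⊗ S))   ≈⟨ ⊗-congˡ P (⊗-congʳ (P ⊗ S) (⊗-assoc Pᵀ S Pᵀ)) ⟨
    P ⊗ (((Pᵀ ⊗ S) ⊗ Pᵀ) ⊗ (P ⊗ S))   ≈⟨ ⊗-congˡ P (⊗-congʳ (P ⊗ S) PᵀSPᵀ≋S) ⟩
    P ⊗ (S ⊗ (P ⊗ S))                 ≈⟨ ⊗-assoc P S (P ⊗ S) ⟨
    (P ⊗ S) ⊗ (P ⊗ S)                 ≈⟨ ⊗-assoc (P ⊗ S) P S ⟨
    ((P ⊗ S) ⊗ P) ⊗ S                 ≈⟨ ⊗-congʳ S PSP≋S ⟩
    S ⊗ S                             ≈⟨ SS≋I ⟩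
    I K                               ∎
    where open SetoidReasoning (≋-setoid K)

  left-inverse : (((S ⊗ Pᵀ) ⊗ (P ⊗ S)) ⊗ (P ⊗ Pᵀ)) ≋ I K
  left-inverse = begin
    ((S ⊗ Pᵀ) ⊗ (P ⊗ S)) ⊗ (P ⊗ Pᵀ)   ≈⟨ ⊗-assoc (S ⊗ Pᵀ) (P ⊗ S) (P ⊗ Pᵀ) ⟩
    (S ⊗ Pᵀ) ⊗ ((P ⊗ S) ⊗ (P ⊗ Pᵀ))   ≈⟨ ⊗-congˡ (S ⊗ Pᵀ) (⊗-assoc (P ⊗ S) P Pᵀ) ⟨
    (S ⊗ Pᵀ) ⊗ (((P ⊗ S) ⊗ P) ⊗ Pᵀ)   ≈⟨ ⊗-congˡ (S ⊗ Pᵀ) (⊗-congʳ Pᵀ PSP≋S) ⟩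
    (S ⊗ Pᵀ) ⊗ (S ⊗ Pᵀ)               ≈⟨ ⊗-assoc S Pᵀ (S ⊗ Pᵀ) ⟩
    S ⊗ (Pᵀ ⊗ (S ⊗ Pᵀ))               ≈⟨ ⊗-congˡ S (⊗-assoc Pᵀ S Pᵀ) ⟨
    S ⊗ ((Pᵀ ⊗ S) ⊗ Pᵀ)               ≈⟨ ⊗-congˡ S PᵀSPᵀ≋S ⟩
    S ⊗ S                             ≈⟨ SS≋I ⟩
    I K                               ∎
    where open SetoidReasoning (≋-setoid K)

binSum-as-sum : ∀ n i j → + binSum n i j ≡ sumBelow (suc n) (λ m → c m i * c m j)
binSum-as-sum zero    i j = trans (ℤP.pos-* (0 C i) (0 C j)) (sym (ℤP.+-identityʳ (c 0 i * c 0 j)))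
binSum-as-sum (suc n) i j = begin
  + (binSum n i j ℕ.+ (suc n C i) ℕ.* (suc n C j))
    ≡⟨ ℤP.pos-+ (binSum n i j) ((suc n C i) ℕ.* (suc n C j)) ⟩
  + binSum n i j + + ((suc n C i) ℕ.* (suc n C j))
    ≡⟨ cong₂ _+_ (binSum-as-sum n i j) (ℤP.pos-* (suc n C i) (suc n C j)) ⟩
  sumBelow (suc n) (λ m → c m i * c m j) + c (suc n) i * c (suc n) j
    ≡⟨ sumBelow-snoc (suc n) (λ m → c m i * c m j) ⟨
  sumBelow (suc (suc n)) (λ m → c m i * c m j) ∎
  where open ≡-Reasoning

module Factorisations (n : ℕ) where
  open PascalMatrices (suc n)

  A≋PPᵀ : A n ≋ (P ⊗ Pᵀ)
  A≋PPᵀ i j = sym (trans (⊗-sum P Pᵀ i j) (vandermonde (suc n) (toℕ i) (toℕ j) (toℕ<n i)))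

  B≋SPᵀPS : B n ≋ ((S ⊗ Pᵀ) ⊗ (P ⊗ S))
  B≋SPᵀPS i j = sym (begin
    ((S ⊗ Pᵀ) ⊗ (P ⊗ S)) i j
      ≡⟨ ⊗-sum (S ⊗ Pᵀ) (P ⊗ S) i j ⟩
    sum (λ l → (S ⊗ Pᵀ) i l * (P ⊗ S) l j)
      ≡⟨ sum-cong-≗ (λ l → cong₂ _*_ (diag-⊗ (signPow ∘ toℕ) Pᵀ i l) (⊗-diag P (signPow ∘ toℕ) l j)) ⟩
    sumBelow (suc n) (λ m → (s i′ * c m i′) * (c m j′ * s j′))
      ≡⟨ sumBelow-cong (suc n) (λ m → regroup (s i′) (c m i′) (c m j′) (s j′)) ⟩
    sumBelow (suc n) (λ m → (s i′ * s j′) * (c m i′ * c m j′))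
      ≡⟨ sumBelow-*ˡ (suc n) (s i′ * s j′) (λ m → c m i′ * c m j′) ⟩
    (s i′ * s j′) * sumBelow (suc n) (λ m → c m i′ * c m j′)
      ≡⟨ cong₂ _*_ (signPow-+ i′ j′) (binSum-as-sum n i′ j′) ⟨
    B n i j ∎)
    where
    open ≡-Reasoning
    s = signPow
    i′ = toℕ i
    j′ = toℕ j
    regroup : ∀ x a b y → (x * a) * (b * y) ≡ (x * y) * (a * b)
    regroup = solve-∀

theorem4p1 : (n : ℕ) →
    ((i j : Fin (suc n)) → (A n ⊗ B n) i j ≡ I (suc n) i j) ×
    ((i j : Fin (suc n)) → (B n ⊗ A n) i j ≡ I (suc n) i j)
theorem4p1 n = A⊗B≋I , B⊗A≋I
  where
  open PascalMatrices (suc n)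
  open Factorisations n
  open SetoidReasoning (≋-setoid (suc n))

  A⊗B≋I : (A n ⊗ B n) ≋ I (suc n)
  A⊗B≋I = begin
    A n ⊗ B n                         ≈⟨ ⊗-cong A≋PPᵀ B≋SPᵀPS ⟩
    (P ⊗ Pᵀ) ⊗ ((S ⊗ Pᵀ) ⊗ (P ⊗ S))   ≈⟨ right-inverse ⟩
    I (suc n)                         ∎

  B⊗A≋I : (B n ⊗ A n) ≋ I (suc n)
  B⊗A≋I = begin
    B n ⊗ A n                         ≈⟨ ⊗-cong B≋SPᵀPS A≋PPᵀ ⟩
    ((S ⊗ Pᵀ) ⊗ (P ⊗ S)) ⊗ (P ⊗ Pᵀ)   ≈⟨ left-inverse ⟩
    I (suc n)                         ∎
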